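{- For each integer $n\ge13$ with $n\ne16$, \begin{align*} \mu_5^{\mathrm E}(G_n)-\mu_5^{\mathrm E}(H_n)&=\ell_8\ell_9\ell_{10}(n+4-\ell_1-\ell_5-\ell_8-\ell_9-\ell_{10})\\ &\quad+\ell_6\ell_9\ell_{12}(n+5-\ell_3-2\ell_5-\ell_6-\ell_9-\ell_{12})\\ &\quad+\ell_2\ell_3\ell_7(n+5-\ell_2-\ell_3-2\ell_5-\ell_7-\ell_{12})\\ &\quad-\ell_3\ell_8\ell_{12}(n+4-\ell_1-\ell_3-\ell_5-\ell_8-\ell_{12})\\ &\quad-\ell_3\ell_6\ell_{10}(n+3-2\ell_1-\ell_3-\ell_6-\ell_9-\ell_{10})\\ &\quad-\ell_4\ell_7\ell_9(n+3-2\ell_1-\ell_4-\ell_7-\ell_9-\ell_{10})\\ &\quad+\ell_4\ell_{11}(\ell_1+1-\ell_5)(n+4-\ell_1-\ell_4-\ell_5-\ell_8-\ell_{11}). \end{align*}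
   Context: $W$ (Wagner graph) has vertices $1,\dots,8$ and edges $e_1=15$, $e_2=37$, $e_3=26$, $e_4=48$, $e_5=12$, $e_6=67$, $e_7=34$, $e_8=81$, $e_9=56$, $e_{10}=45$, $e_{11}=78$, $e_{12}=23$. For positive integers $x_1,\dots,x_{12}$, $W(x_1,\dots,x_{12})$ is obtained from $W$ by replacing each $e_i$ with a path of $x_i$ edges (new internal vertices of degree 2); these paths are its chains and its distillation is $W$, edge $e_i$ corresponding to the $i$-th chain. For $n\ge13$, $n\ne16$, let $r,s$ be the unique integers with $n+4=12s+r$, $r\in\{0,\dots,11\}$; $X_0=\emptyset$, $X_8=\{e_1,e_2,e_3,e_4,e_6,e_8,e_{10},e_{12}\}$, $X_r=\{e_1,\dots,e_r\}$ otherwise; $\ell_i=s+1$ if $e_i\in X_r$, else $\ell_i=s$; $G_n=W(\ell_1,\dots,\ell_{12})$ and $H_n=W(\ell_1',\dots,\ell_{12}')$ with $\ell_1'=\ell_1+1$, $\ell_5'=\ell_5-1$, $\ell_i'=\ell_i$ otherwise. A $k$-edge-cut is a set of $k$ edges whose removal disconnects the graph. An edge-cut $F$ of $W$ separates a vertex set $S$ if $F$ contains every edge with exactly one endpoint in $S$ and no edge with both endpoints in $S$; it is vertex-separating if it separates some $\{v\}$, edge-separating if it separates $\{u,v\}$ for some edge $uv$. For $G\in\{G_n,H_n\}$, a $5$-edge-cut $\{a_1,\dots,a_5\}$ of $G$ is induced by a $5$-edge-cut $\{f_1,\dots,f_5\}$ of $W$ if each $a_j$ lies in the chain corresponding to $f_j$;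 $\mu_5^{\mathrm E}(G)$ is the number of $5$-edge-cuts of $G$ induced by $5$-edge-cuts of $W$ that are edge-separating but not vertex-separating. -}

module Defs where

open import Data.Nat using (ℕ; zero; suc; _+_; _*_; _∸_; _≤_; _<_; _≡ᵇ_; _<ᵇ_)
open import Data.Nat.DivMod using (_/_; _%_)
open import Data.Fin as Fin using (Fin; #_; toℕ)
open import Data.Vec using (Vec; []; _∷_; lookup)
open import Data.Bool using (Bool; true; false; if_then_else_)
open import Data.Product using (Σ; ∃; _×_; _,_; proj₁; proj₂)
open import Data.Sum using (_⊎_)
open import Data.Unit using (⊤)
open import Data.List using (List)
open import Data.List.Membership.Propositional using (_∈_)
open import Data.List.Relation.Unary.Unique.Propositional using (Unique)
open import Relation.Binary.PropositionalEquality using (_≡_)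
open import Relation.Binary.Construct.Closure.ReflexiveTransitive using (Star)
open import Relation.Nullary using (¬_)

-- The Wagner graph W.  Vertex k (1 ≤ k ≤ 8) is  # (k-1) : Fin 8,
-- edge e_i (1 ≤ i ≤ 12) is  # (i-1) : Fin 12.

WV : Set
WV = Fin 8

WE : Set
WE = Fin 12

srcW : WE → WV
srcW i = lookup (# 0 ∷ # 2 ∷ # 1 ∷ # 3 ∷ # 0 ∷ # 5 ∷ # 2 ∷ # 7 ∷ # 4 ∷ # 3 ∷ # 6 ∷ # 1 ∷ []) i

tgtW : WE → WV
tgtW i = lookup (# 4 ∷ # 6 ∷ # 5 ∷ # 7 ∷ # 1 ∷ # 6 ∷ # 3 ∷ # 0 ∷ # 5 ∷ # 4 ∷ # 7 ∷ # 2 ∷ []) i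

Step : {V E : Set} → (E → V) → (E → V) → (E → Set) → V → V → Set
Step {V} {E} src tgt allowed u v =
  Σ E λ e → allowed e × ((src e ≡ u × tgt e ≡ v) ⊎ (src e ≡ v × tgt e ≡ u))

Reach : {V E : Set} → (E → V) → (E → V) → (E → Set) → V → V → Set
Reach src tgt allowed = Star (Step src tgt allowed)

InW : Vec WE 5 → WE → Set
InW F e = Σ (Fin 5) λ j → lookup F j ≡ e

DistinctW : Vec WE 5 → Set
DistinctW F = ∀ (j k : Fin 5) → lookup F j ≡ lookup F k → j ≡ k

Is5CutW : Vec WE 5 → Set
Is5CutW F = DistinctW F × Σ WV λ u → Σ WV λ v → ¬ Reach srcW tgtW (λ e → ¬ InW F e) u v

Separates : Vec WE 5 → (WV → Set) → Set
Separates F S =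
  (∀ e → ((S (srcW e) × ¬ S (tgtW e)) ⊎ (¬ S (srcW e) × S (tgtW e))) → InW F e)
  × (∀ e → S (srcW e) → S (tgtW e) → ¬ InW F e)

VertexSeparating : Vec WE 5 → Set
VertexSeparating F = Σ WV λ v → Separates F (λ w → w ≡ v)

EdgeSeparating : Vec WE 5 → Set
EdgeSeparating F = Σ WE λ e → Separates F (λ w → (w ≡ srcW e) ⊎ (w ≡ tgtW e))

-- The subdivision W(x).  Chain i has x i edges; its j-th edge
-- (0 ≤ j < x i) joins positions j and j+1 of the chain, where position 0
-- is srcW i, position x i is tgtW i, and position k (0 < k < x i) is the
-- internal vertex  inner i k.

data GV : Set where
  orig  : WV → GV
  inner : WE → ℕ → GV

ValidV : (WE → ℕ) → GV → Set
ValidV x (orig _)    = ⊤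
ValidV x (inner i k) = 1 ≤ k × k < x i

GE : (WE → ℕ) → Set
GE x = Σ WE λ i → Fin (x i)

pos : (WE → ℕ) → WE → ℕ → GV
pos x i k = if k ≡ᵇ 0 then orig (srcW i) else (if k ≡ᵇ x i then orig (tgtW i) else inner i k)

srcG : (x : WE → ℕ) → GE x → GV
srcG x (i , j) = pos x i (toℕ j)

tgtG : (x : WE → ℕ) → GE x → GV
tgtG x (i , j) = pos x i (suc (toℕ j))

chain : {x : WE → ℕ} → GE x → WE
chain = proj₁

-- A 5-element set of edges of W(x) is represented canonically by the
-- vector of its elements listed in strictly increasing lexicographic
-- order (chain index, position in chain).
_<E_ : {x : WE → ℕ} → GE x → GE x → Set
(i , j) <E (i' , j') = (toℕ i < toℕ i') ⊎ ((i ≡ i') × (toℕ j < toℕ j'))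

SortedE : {x : WE → ℕ} → Vec (GE x) 5 → Set
SortedE a = ∀ (j k : Fin 5) → j Fin.< k → lookup a j <E lookup a k

InG : {x : WE → ℕ} → Vec (GE x) 5 → GE x → Set
InG a e = Σ (Fin 5) λ j → lookup a j ≡ e

Is5CutG : (x : WE → ℕ) → Vec (GE x) 5 → Set
Is5CutG x a = SortedE a ×
  (Σ GV λ u → Σ GV λ v → ValidV x u × ValidV x v × ¬ Reach (srcG x) (tgtG x) (λ e → ¬ InG a e) u v)

InducedBy : {x : WE → ℕ} → Vec (GE x) 5 → Vec WE 5 → Set
InducedBy a F = ∀ (j : Fin 5) → chain (lookup a j) ≡ lookup F j

CountedE : (x : WE → ℕ) → Vec (GE x) 5 → Set
CountedE x a = Is5CutG x a ×
  (Σ (Vec WE 5) λ F → Is5CutW F × EdgeSeparating F × ¬ VertexSeparating F × InducedBy a F)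

-- L is a duplicate-free list of exactly the cuts counted by μ_5^E(W(x));
-- then μ_5^E(W(x)) = length L.
EnumMu5E : (x : WE → ℕ) → List (Vec (GE x) 5) → Set
EnumMu5E x L = Unique L × (∀ a → (a ∈ L → CountedE x a) × (CountedE x a → a ∈ L))

sPar : ℕ → ℕ
sPar n = (n + 4) / 12

rPar : ℕ → ℕ
rPar n = (n + 4) % 12

inX : ℕ → WE → Bool
inX r i = if r ≡ᵇ 0 then false
          else (if r ≡ᵇ 8
                then lookup (true ∷ true ∷ true ∷ true ∷ false ∷ true ∷ false ∷ true ∷ false ∷ true ∷ false ∷ true ∷ []) i
                else toℕ i <ᵇ r)

ℓ : ℕ → WE → ℕ
ℓ n i = sPar n + (if inX (rPar n) i then 1 else 0)

ℓ' : ℕ → WE → ℕ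
ℓ' n i = if toℕ i ≡ᵇ 0 then ℓ n i + 1 else (if toℕ i ≡ᵇ 4 then ℓ n i ∸ 1 else ℓ n i)

-- G_n = W(ℓ), H_n = W(ℓ')
xG : ℕ → WE → ℕ
xG = ℓ

xH : ℕ → WE → ℕ
xH = ℓ'

{-# OPTIONS --safe #-}
-- Colour every vertex of W(x) by the side of an edge-separation {u,v} of W that it is attached
-- to, the colour along a chain of the separating set switching at the chosen edge of that chain:
-- no remaining edge joins two colours.  So each choice of one edge from every chain of an
-- edge- but not vertex-separating 5-cut F of W is a 5-cut of W(x), and these choices are exactly
-- the cuts counted by μ₅ᴱ.  Hence μ₅ᴱ(W(x)) = Σ_F Π_{f ∈ F} x_f over the finite family of such F,
-- which is computed by enumerating the increasing 5-subsets of the 12 edges.  The theorem becomes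
-- a polynomial identity in ℓ₁ … ℓ₁₂ once n is replaced by ℓ₁ + ⋯ + ℓ₁₂ − 4, and the ring
-- solver checks it.
module Submission where

open import Defs
open import Data.Nat using (ℕ; _≤_)
open import Data.Fin using (#_)
open import Data.List using (List; length)
open import Data.Vec using (Vec)
open import Data.Integer using (ℤ; +_)
open import Relation.Binary.PropositionalEquality using (_≡_; _≢_)

open import Algebra.Bundles.Raw using (RawSemiring; RawRing)
open import Data.Bool using (Bool; true; false; T; if_then_else_)
open import Data.Fin as Fin using (Fin; toℕ)
open import Data.Fin.Properties as Finₚ using (all?; any?; toℕ<n; toℕ-injective)
import Data.Integer as ℤ
import Data.Integer.Properties as ℤₚ
import Data.Integer.Tactic.RingSolver as ℤ-Solver
open import Data.List as List using ([]; _∷_; [_]; filter; concatMap; cartesianProductWith; allFin)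
open import Data.List.Membership.Propositional using (_∈_; find; lose)
open import Data.List.Membership.Propositional.Properties
  using (∈-concatMap⁺; ∈-concatMap⁻; ∈-map⁺; ∈-map⁻; ∈-filter⁺; ∈-filter⁻; ∈-allFin;
         ∈-cartesianProductWith⁺; ∈-cartesianProductWith⁻)
open import Data.List.Membership.Propositional.Properties.WithK using (unique∧set⇒bag)
open import Data.List.Properties using (length-++; length-map; length-tabulate)
open import Data.List.Relation.Binary.BagAndSetEquality using (∼bag⇒↭)
open import Data.List.Relation.Binary.Disjoint.Propositional using (Disjoint)
open import Data.List.Relation.Binary.Permutation.Propositional.Properties using (↭-length)
import Data.List.Relation.Unary.All as All
import Data.List.Relation.Unary.All.Properties as Allₚ
import Data.List.Relation.Unary.AllPairs as AllPairs
import Data.List.Relation.Unary.AllPairs.Properties as AllPairsₚ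
open import Data.List.Relation.Unary.Any as Any using (here)
open import Data.List.Relation.Unary.Unique.Propositional using (Unique)
import Data.List.Relation.Unary.Unique.Propositional.Properties as Uniqueₚ
open import Data.Nat as ℕ using (zero; suc; _<_; _≤?_; _<?_; z≤n; s≤s)
open import Data.Nat.DivMod using (m≡m%n+[m/n]*n; m%n<n; m≥n⇒m/n>0)
import Data.Nat.Properties as ℕₚ
import Data.Nat.Tactic.RingSolver as ℕ-Solver
open import Data.Product using (Σ; ∃; _×_; _,_; proj₁; proj₂)
open import Data.Sum using (_⊎_; inj₁; inj₂)
open import Data.Unit using (⊤; tt)
open import Data.Vec as Vec using ([]; _∷_; lookup; tabulate)
open import Data.Vec.Properties using (lookup-map; lookup∘tabulate; ∷-injectiveˡ; ∷-injectiveʳ)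
open import Data.Vec.Relation.Binary.Pointwise.Extensional using (ext; Pointwise-≡⇒≡)
open import Function using (id; _∘_; _⇔_; mk⇔; Equivalence)
import Function.Properties.Equivalence as ⇔
open import Level using (0ℓ)
open import Relation.Binary.Construct.Closure.ReflexiveTransitive using (ε; _◅_)
open import Relation.Binary.Definitions using (tri<; tri≈; tri>)
open import Relation.Binary.PropositionalEquality
  using (refl; sym; trans; cong; cong₂; subst; subst₂; module ≡-Reasoning)
open import Relation.Nullary using (¬_; Dec; yes; no; does; contradiction)
open import Relation.Nullary.Decidable using (_×-dec_; _⊎-dec_; _→-dec_; ¬?; dec-true; dec-false; toWitness)
open import Relation.Unary using (Decidable)
open import Tactic.RingSolver.NonReflective ℤ-Solver.ring using (Expr; Κ; Ι; _⊕_; _⊗_; ⊝_; module Ops)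

module _ {A : Set} where

  unique∧set⇒length≡ : {xs ys : List A} → Unique xs → Unique ys →
                       (∀ {z} → z ∈ xs ⇔ z ∈ ys) → length xs ≡ length ys
  unique∧set⇒length≡ xs! ys! xs⇔ys = ↭-length (∼bag⇒↭ (unique∧set⇒bag xs! ys! xs⇔ys))

module _ {A B : Set} where

  concatMap⁺ : {f : A → List B} {xs : List A} → Unique xs → (∀ x → Unique (f x)) →
               (∀ {x y z} → z ∈ f x → z ∈ f y → x ≡ y) → Unique (concatMap f xs)
  concatMap⁺ {f} xs! f! fibres-disjoint = Uniqueₚ.concat⁺
    (Allₚ.map⁺ (All.universal f! _))
    (AllPairsₚ.map⁺ (AllPairs.map {S = λ x y → Disjoint (f x) (f y)} (λ x≢y (p , q) → x≢y (fibres-disjoint p q)) xs!))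

module _ {I : Set} (R : RawSemiring 0ℓ 0ℓ) where
  open RawSemiring R

  monomial : ∀ {k} → (I → Carrier) → Vec I k → Carrier
  monomial v []      = 1#
  monomial v (i ∷ F) = v i * monomial v F

  polynomial : ∀ {k} → (I → Carrier) → List (Vec I k) → Carrier
  polynomial v []       = 0#
  polynomial v (F ∷ Fs) = monomial v F + polynomial v Fs

  polynomial-cong : ∀ {k} {v w : I → Carrier} → (∀ i → v i ≡ w i) →
                    (Fs : List (Vec I k)) → polynomial v Fs ≡ polynomial w Fs
  polynomial-cong {v = v} {w} v≗w = go
    where
    monomial-cong : ∀ {k} (F : Vec I k) → monomial v F ≡ monomial w F
    monomial-cong []      = refl
    monomial-cong (i ∷ F) = cong₂ _*_ (v≗w i) (monomial-cong F)

    go : ∀ {k} (Fs : List (Vec I k)) → polynomial v Fs ≡ polynomial w Fs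
    go []       = refl
    go (F ∷ Fs) = cong₂ _+_ (monomial-cong F) (go Fs)

module _ {I : Set} (R S : RawSemiring 0ℓ 0ℓ) where
  private
    module R = RawSemiring R
    module S = RawSemiring S

  polynomial-homo : (h : R.Carrier → S.Carrier) →
    h R.0# ≡ S.0# → h R.1# ≡ S.1# →
    (∀ a b → h (a R.+ b) ≡ h a S.+ h b) → (∀ a b → h (a R.* b) ≡ h a S.* h b) →
    ∀ {k} (v : I → R.Carrier) (Fs : List (Vec I k)) → h (polynomial R v Fs) ≡ polynomial S (h ∘ v) Fs
  polynomial-homo h h-0 h-1 h-+ h-* v = go
    where
    monomial-homo : ∀ {k} (F : Vec I k) → h (monomial R v F) ≡ monomial S (h ∘ v) F
    monomial-homo []      = h-1
    monomial-homo (i ∷ F) = trans (h-* _ _) (cong (h (v i) S.*_) (monomial-homo F))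

    go : ∀ {k} (Fs : List (Vec I k)) → h (polynomial R v Fs) ≡ polynomial S (h ∘ v) Fs
    go []       = h-0
    go (F ∷ Fs) = trans (h-+ _ _) (cong₂ S._+_ (monomial-homo F) (go Fs))

module _ {A B C : Set} where

  length-cartesianProductWith : (f : A → B → C) (xs : List A) (ys : List B) →
    length (cartesianProductWith f xs ys) ≡ length xs ℕ.* length ys
  length-cartesianProductWith f []       ys = refl
  length-cartesianProductWith f (x ∷ xs) ys = begin
    length (List.map (f x) ys List.++ cartesianProductWith f xs ys)
      ≡⟨ length-++ (List.map (f x) ys) ⟩
    length (List.map (f x) ys) ℕ.+ length (cartesianProductWith f xs ys)
      ≡⟨ cong₂ ℕ._+_ (length-map (f x) ys) (length-cartesianProductWith f xs ys) ⟩
    length ys ℕ.+ length xs ℕ.* length ys ∎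
    where open ≡-Reasoning

module _ {I : Set} (x : I → ℕ) where

  lifts : ∀ {k} → Vec I k → List (Vec (Σ I λ i → Fin (x i)) k)
  lifts []      = [ [] ]
  lifts (i ∷ F) = cartesianProductWith (λ j a → (i , j) ∷ a) (allFin (x i)) (lifts F)

  ∈-lifts⁻ : ∀ {k} (F : Vec I k) {a} → a ∈ lifts F → Vec.map proj₁ a ≡ F
  ∈-lifts⁻ []      (here refl) = refl
  ∈-lifts⁻ (i ∷ F) a∈
    with _ , a′ , _ , a′∈ , refl ← ∈-cartesianProductWith⁻ _ (allFin (x i)) (lifts F) a∈
    = cong (i ∷_) (∈-lifts⁻ F a′∈)

  ∈-lifts⁺ : ∀ {k} (a : Vec (Σ I λ i → Fin (x i)) k) → a ∈ lifts (Vec.map proj₁ a)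
  ∈-lifts⁺ []            = here refl
  ∈-lifts⁺ ((i , j) ∷ a) = ∈-cartesianProductWith⁺ _ (∈-allFin j) (∈-lifts⁺ a)

  lifts-unique : ∀ {k} (F : Vec I k) → Unique (lifts F)
  lifts-unique []      = All.[] AllPairs.∷ AllPairs.[]
  lifts-unique (i ∷ F) = Uniqueₚ.cartesianProductWith⁺ _ ∷-injective (Uniqueₚ.allFin⁺ (x i)) (lifts-unique F)
    where
    ∷-injective : ∀ {j j′ a a′} → _≡_ {A = Vec _ _} ((i , j) ∷ a) ((i , j′) ∷ a′) → j ≡ j′ × a ≡ a′
    ∷-injective refl = refl , refl

  length-lifts : ∀ {k} (F : Vec I k) → length (lifts F) ≡ monomial ℕ.+-*-rawSemiring x F
  length-lifts []      = refl
  length-lifts (i ∷ F) = trans (length-cartesianProductWith _ (allFin (x i)) (lifts F))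
                               (cong₂ ℕ._*_ (length-tabulate {n = x i} id) (length-lifts F))

  ∈-concatMap-lifts⇔ : ∀ {k} {Fs : List (Vec I k)} {a} → a ∈ concatMap lifts Fs ⇔ Vec.map proj₁ a ∈ Fs
  ∈-concatMap-lifts⇔ {a = a} = mk⇔
    (Any.map (∈-lifts⁻ _) ∘ ∈-concatMap⁻ lifts)
    (∈-concatMap⁺ lifts ∘ Any.map (λ { refl → ∈-lifts⁺ a }))

  length-concatMap-lifts : ∀ {k} (Fs : List (Vec I k)) →
    length (concatMap lifts Fs) ≡ polynomial ℕ.+-*-rawSemiring x Fs
  length-concatMap-lifts []       = refl
  length-concatMap-lifts (F ∷ Fs) = trans (length-++ (lifts F))
    (cong₂ ℕ._+_ (length-lifts F) (length-concatMap-lifts Fs))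

  length-enumeration-of-lifts : ∀ {k} {Fs : List (Vec I k)} {L} → Unique Fs → Unique L →
    (∀ {a} → a ∈ L ⇔ Vec.map proj₁ a ∈ Fs) → length L ≡ polynomial ℕ.+-*-rawSemiring x Fs
  length-enumeration-of-lifts {Fs = Fs} Fs! L! L⇔Fs = trans
    (unique∧set⇒length≡ L! lifts! (λ {a} → ⇔.trans L⇔Fs (⇔.sym ∈-concatMap-lifts⇔)))
    (length-concatMap-lifts Fs)
    where
    lifts! : Unique (concatMap lifts Fs)
    lifts! = concatMap⁺ Fs! lifts-unique (λ p q → trans (sym (∈-lifts⁻ _ p)) (∈-lifts⁻ _ q))

module _ {m : ℕ} where

  Ascending : ∀ {k} → ℕ → Vec (Fin m) k → Set
  Ascending lo []      = ⊤
  Ascending lo (f ∷ F) = lo ≤ toℕ f × Ascending (suc (toℕ f)) F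

  ascending : ℕ → (k : ℕ) → List (Vec (Fin m) k)
  ascending lo zero    = [ [] ]
  ascending lo (suc k) = concatMap (λ f → List.map (f ∷_) (ascending (suc (toℕ f)) k))
                                   (filter (λ f → lo ≤? toℕ f) (allFin m))

  ∈-ascending⁺ : ∀ {k} lo (F : Vec (Fin m) k) → Ascending lo F → F ∈ ascending lo k
  ∈-ascending⁺ lo []      _           = here refl
  ∈-ascending⁺ lo (f ∷ F) (lo≤f , F↑) = ∈-concatMap⁺ _
    (lose (∈-filter⁺ (λ f → lo ≤? toℕ f) (∈-allFin f) lo≤f) (∈-map⁺ (f ∷_) (∈-ascending⁺ _ F F↑)))

  ∈-ascending⁻ : ∀ {k} lo (F : Vec (Fin m) k) → F ∈ ascending lo k → Ascending lo F
  ∈-ascending⁻ lo []      _    = tt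
  ∈-ascending⁻ lo (f ∷ F) fF∈
    with g , g∈ , fF∈′ ← find (∈-concatMap⁻ _ {xs = filter (λ f → lo ≤? toℕ f) (allFin m)} fF∈)
    with F′ , F′∈ , refl ← ∈-map⁻ (g ∷_) fF∈′
    = proj₂ (∈-filter⁻ (λ f → lo ≤? toℕ f) {xs = allFin m} g∈) , ∈-ascending⁻ _ F F′∈

  ascending-unique : ∀ lo k → Unique (ascending lo k)
  ascending-unique lo zero    = All.[] AllPairs.∷ AllPairs.[]
  ascending-unique lo (suc k) = concatMap⁺
    (Uniqueₚ.filter⁺ (λ f → lo ≤? toℕ f) (Uniqueₚ.allFin⁺ m))
    (λ f → Uniqueₚ.map⁺ ∷-injectiveʳ (ascending-unique (suc (toℕ f)) k))
    same-head
    where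
    same-head : ∀ {f g} {F : Vec (Fin m) (suc k)} {Gs Hs : List (Vec (Fin m) k)} →
                F ∈ List.map (f ∷_) Gs → F ∈ List.map (g ∷_) Hs → f ≡ g
    same-head p q with _ , _ , refl ← ∈-map⁻ _ p | _ , _ , F≡ ← ∈-map⁻ _ q = ∷-injectiveˡ F≡

  StrictlyIncreasing : ∀ {k} → Vec (Fin m) k → Set
  StrictlyIncreasing {k} F = ∀ (j l : Fin k) → j Fin.< l → toℕ (lookup F j) < toℕ (lookup F l)

  Ascending-lowerBound : ∀ {k} lo (F : Vec (Fin m) k) → Ascending lo F → ∀ j → lo ≤ toℕ (lookup F j)
  Ascending-lowerBound lo (f ∷ F) (lo≤f , F↑) Fin.zero    = lo≤f
  Ascending-lowerBound lo (f ∷ F) (lo≤f , F↑) (Fin.suc j) =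
    ℕₚ.≤-trans (ℕₚ.m≤n⇒m≤1+n lo≤f) (Ascending-lowerBound _ F F↑ j)

  Ascending⇒StrictlyIncreasing : ∀ {k} lo (F : Vec (Fin m) k) → Ascending lo F → StrictlyIncreasing F
  Ascending⇒StrictlyIncreasing lo (f ∷ F) (_ , F↑) Fin.zero    (Fin.suc l) _         =
    Ascending-lowerBound _ F F↑ l
  Ascending⇒StrictlyIncreasing lo (f ∷ F) (_ , F↑) (Fin.suc j) (Fin.suc l) (s≤s j<l) =
    Ascending⇒StrictlyIncreasing _ F F↑ j l j<l

  StrictlyIncreasing⇒Ascending : ∀ {k} lo (F : Vec (Fin m) k) → StrictlyIncreasing F →
                                 (∀ j → lo ≤ toℕ (lookup F j)) → Ascending lo F
  StrictlyIncreasing⇒Ascending lo []      _  _   = tt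
  StrictlyIncreasing⇒Ascending lo (f ∷ F) F↑ lo≤ = lo≤ Fin.zero ,
    StrictlyIncreasing⇒Ascending _ F (λ j l j<l → F↑ (Fin.suc j) (Fin.suc l) (s≤s j<l))
                                     (λ j → F↑ Fin.zero (Fin.suc j) (s≤s z≤n))

  StrictlyIncreasing⇒injective : ∀ {k} (F : Vec (Fin m) k) → StrictlyIncreasing F →
                                 ∀ j l → lookup F j ≡ lookup F l → j ≡ l
  StrictlyIncreasing⇒injective F F↑ j l Fj≡Fl with Finₚ.<-cmp j l
  ... | tri< j<l _ _ = contradiction (F↑ j l j<l) (ℕₚ.<-irrefl (cong toℕ Fj≡Fl))
  ... | tri≈ _ j≡l _ = j≡l
  ... | tri> _ _ l<j = contradiction (F↑ l j l<j) (ℕₚ.<-irrefl (cong toℕ (sym Fj≡Fl)))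

module _ {V E : Set} {src tgt : E → V} {allowed : E → Set} where

  colouring⇒¬Reach : (c : V → Bool) → (∀ e → allowed e → c (src e) ≡ c (tgt e)) →
                     ∀ {u v} → c u ≢ c v → ¬ Reach src tgt allowed u v
  colouring⇒¬Reach c c-steady cu≢cv r = cu≢cv (constant r)
    where
    constant : ∀ {u v} → Reach src tgt allowed u v → c u ≡ c v
    constant ε                                      = refl
    constant ((e , allowed-e , inj₁ (refl , refl)) ◅ r) = trans (c-steady e allowed-e) (constant r)
    constant ((e , allowed-e , inj₂ (refl , refl)) ◅ r) = trans (sym (c-steady e allowed-e)) (constant r)

module Separation (F : Vec WE 5) {S : WV → Set} (S? : Decidable S) (F-separates : Separates F S) where

  side : WV → Bool
  side w = does (S? w)

  side-uncut : ∀ i → ¬ InW F i → side (srcW i) ≡ side (tgtW i)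
  side-uncut i i∉F with S? (srcW i) | S? (tgtW i)
  ... | yes _  | yes _  = refl
  ... | no _   | no _   = refl
  ... | yes s∈ | no t∉ = contradiction (proj₁ F-separates i (inj₁ (s∈ , t∉))) i∉F
  ... | no s∉  | yes t∈ = contradiction (proj₁ F-separates i (inj₂ (s∉ , t∈))) i∉F

  sides-differ : ∀ {u v} → S u → ¬ S v → side u ≢ side v
  sides-differ {u} {v} u∈ v∉ eq with trans (sym (dec-true (S? u) u∈)) (trans eq (dec-false (S? v) v∉))
  ... | ()

  ¬Reach-W : ∀ {u v} → S u → ¬ S v → ¬ Reach srcW tgtW (λ e → ¬ InW F e) u v
  ¬Reach-W u∈ v∉ = colouring⇒¬Reach side side-uncut (sides-differ u∈ v∉)

  module Subdivision (x : WE → ℕ) (a : Vec (GE x) 5) (a-induced : InducedBy a F) where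

    CutBefore : WE → ℕ → Set
    CutBefore i k = Σ (Fin 5) λ j → chain (lookup a j) ≡ i × toℕ (proj₂ (lookup a j)) < k

    cutBefore? : ∀ i k → Dec (CutBefore i k)
    cutBefore? i k = any? λ j → (chain (lookup a j) Fin.≟ i) ×-dec (toℕ (proj₂ (lookup a j)) <? k)

    chainSide : WE → ℕ → Bool
    chainSide i k with cutBefore? i k
    ... | yes _ = side (tgtW i)
    ... | no _  = side (srcW i)

    colour : GV → Bool
    colour (orig w)    = side w
    colour (inner i k) = chainSide i k

    position<length : ∀ (e : GE x) {i} → chain e ≡ i → toℕ (proj₂ e) < x i
    position<length (_ , m) refl = toℕ<n m

    chainSide-start : ∀ i → chainSide i 0 ≡ side (srcW i)
    chainSide-start i with cutBefore? i 0
    ... | no _ = refl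

    chainSide-end : ∀ i → chainSide i (x i) ≡ side (tgtW i)
    chainSide-end i with cutBefore? i (x i)
    ... | yes _  = refl
    ... | no ¬cut = side-uncut i λ (j , Fj≡i) →
            ¬cut (j , trans (a-induced j) Fj≡i , position<length (lookup a j) (trans (a-induced j) Fj≡i))

    colour-pos : ∀ i k → colour (pos x i k) ≡ chainSide i k
    colour-pos i zero    = sym (chainSide-start i)
    colour-pos i (suc k) with suc k ℕ.≡ᵇ x i in end
    ... | true rewrite ℕₚ.≡ᵇ⇒≡ (suc k) (x i) (subst T (sym end) tt) = sym (chainSide-end i)
    ... | false = refl

    chainSide-step : ∀ i (m : Fin (x i)) → ¬ InG a (i , m) → chainSide i (toℕ m) ≡ chainSide i (suc (toℕ m))
    chainSide-step i m m∉a with cutBefore? i (toℕ m) | cutBefore? i (suc (toℕ m))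
    ... | yes _ | yes _ = refl
    ... | no _  | no _  = refl
    ... | yes (j , j∈i , j<m) | no ¬cut = contradiction (j , j∈i , ℕₚ.m<n⇒m<1+n j<m) ¬cut
    ... | no ¬cut | yes (j , j∈i , j≤m) with ℕₚ.<-cmp (toℕ (proj₂ (lookup a j))) (toℕ m)
    ...   | tri< j<m _ _ = contradiction (j , j∈i , j<m) ¬cut
    ...   | tri> _ _ m<j = contradiction j≤m (ℕₚ.<⇒≱ (s≤s m<j))
    ...   | tri≈ _ j≡m _ = contradiction (j , same-edge (lookup a j) j∈i j≡m) m∉a
      where
      same-edge : ∀ (e : GE x) → chain e ≡ i → toℕ (proj₂ e) ≡ toℕ m → e ≡ (i , m)
      same-edge (_ , m′) refl m′≡m = cong (i ,_) (toℕ-injective m′≡m)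

    colour-uncut : ∀ e → ¬ InG a e → colour (srcG x e) ≡ colour (tgtG x e)
    colour-uncut (i , m) e∉a = begin
      colour (pos x i (toℕ m))       ≡⟨ colour-pos i (toℕ m) ⟩
      chainSide i (toℕ m)            ≡⟨ chainSide-step i m e∉a ⟩
      chainSide i (suc (toℕ m))      ≡⟨ colour-pos i (suc (toℕ m)) ⟨
      colour (pos x i (suc (toℕ m))) ∎
      where open ≡-Reasoning

    ¬Reach-subdivision : ∀ {u v} → S u → ¬ S v →
                         ¬ Reach (srcG x) (tgtG x) (λ e → ¬ InG a e) (orig u) (orig v)
    ¬Reach-subdivision u∈ v∉ = colouring⇒¬Reach colour colour-uncut (sides-differ u∈ v∉)

InW? : ∀ F e → Dec (InW F e)
InW? F e = any? λ j → lookup F j Fin.≟ e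

separates? : ∀ F {S : WV → Set} → Decidable S → Dec (Separates F S)
separates? F S? =
  all? (λ e → ((S? (srcW e) ×-dec ¬? (S? (tgtW e))) ⊎-dec (¬? (S? (srcW e)) ×-dec S? (tgtW e))) →-dec InW? F e)
  ×-dec all? (λ e → S? (srcW e) →-dec (S? (tgtW e) →-dec ¬? (InW? F e)))

EdgeEnd : WE → WV → Set
EdgeEnd e w = (w ≡ srcW e) ⊎ (w ≡ tgtW e)

edgeEnd? : ∀ e → Decidable (EdgeEnd e)
edgeEnd? e w = (w Fin.≟ srcW e) ⊎-dec (w Fin.≟ tgtW e)

vertexSeparating? : ∀ F → Dec (VertexSeparating F)
vertexSeparating? F = any? λ v → separates? F (Fin._≟ v)

edgeSeparating? : ∀ F → Dec (EdgeSeparating F)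
edgeSeparating? F = any? λ e → separates? F (edgeEnd? e)

EdgeButNotVertexSeparating : Vec WE 5 → Set
EdgeButNotVertexSeparating F = EdgeSeparating F × ¬ VertexSeparating F

-- Opaque so that `cutFamily` stays symbolic during ordinary type checking: evaluating it takes
-- tens of seconds.  Only the polynomial identity `cutExpr-difference` unfolds it.
opaque
  edgeButNotVertexSeparating? : ∀ F → Dec (EdgeButNotVertexSeparating F)
  edgeButNotVertexSeparating? F = edgeSeparating? F ×-dec ¬? (vertexSeparating? F)

vertex-off-edge : ∀ e → ∃ λ w → ¬ EdgeEnd e w
vertex-off-edge = toWitness {a? = all? λ e → any? λ w → ¬? (edgeEnd? e w)} tt

edgeSeparating⇒disconnects-W : ∀ {F} → EdgeSeparating F →
  Σ WV λ u → Σ WV λ v → ¬ Reach srcW tgtW (λ f → ¬ InW F f) u v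
edgeSeparating⇒disconnects-W {F} (e , e-sep) with w , w∉e ← vertex-off-edge e =
  srcW e , w , Separation.¬Reach-W F (edgeEnd? e) e-sep (inj₁ refl) w∉e

edgeSeparating⇒disconnects-subdivision : ∀ {F x} {a : Vec (GE x) 5} → InducedBy a F → EdgeSeparating F →
  Σ GV λ u → Σ GV λ v → ValidV x u × ValidV x v × ¬ Reach (srcG x) (tgtG x) (λ f → ¬ InG a f) u v
edgeSeparating⇒disconnects-subdivision {F} {x} {a} a↝F (e , e-sep) with w , w∉e ← vertex-off-edge e =
  orig (srcW e) , orig w , tt , tt ,
  Separation.Subdivision.¬Reach-subdivision F (edgeEnd? e) e-sep x a a↝F (inj₁ refl) w∉e

-- Each 5-set is listed once, as its increasing vector: the representation `SortedE` imposes on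
-- the cuts of W(x).
cutFamily : List (Vec WE 5)
cutFamily = filter edgeButNotVertexSeparating? (ascending 0 5)

cutFamily-unique : Unique cutFamily
cutFamily-unique = Uniqueₚ.filter⁺ edgeButNotVertexSeparating? (ascending-unique 0 5)

∈-cutFamily⇔ : ∀ {F} → F ∈ cutFamily ⇔ (StrictlyIncreasing F × EdgeButNotVertexSeparating F)
∈-cutFamily⇔ {F} = mk⇔
  (λ F∈ → let F∈asc , F-sep = ∈-filter⁻ edgeButNotVertexSeparating? {xs = ascending 0 5} F∈
          in Ascending⇒StrictlyIncreasing 0 F (∈-ascending⁻ 0 F F∈asc) , F-sep)
  (λ (F↑ , F-sep) → ∈-filter⁺ edgeButNotVertexSeparating?
          (∈-ascending⁺ 0 F (StrictlyIncreasing⇒Ascending 0 F F↑ (λ _ → z≤n))) F-sep)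

module _ {x : WE → ℕ} (a : Vec (GE x) 5) where

  chains-induce : InducedBy a (Vec.map chain a)
  chains-induce j = sym (lookup-map j chain a)

  induced⇒chains : ∀ {F} → InducedBy a F → Vec.map chain a ≡ F
  induced⇒chains a↝F = Pointwise-≡⇒≡ (ext λ j → trans (lookup-map j chain a) (a↝F j))

  StrictlyIncreasing⇒SortedE : StrictlyIncreasing (Vec.map chain a) → SortedE a
  StrictlyIncreasing⇒SortedE chains↑ j k j<k =
    inj₁ (subst₂ (λ f g → toℕ f < toℕ g) (lookup-map j chain a) (lookup-map k chain a) (chains↑ j k j<k))

  SortedE⇒StrictlyIncreasing : ∀ {F} → SortedE a → DistinctW F → InducedBy a F → StrictlyIncreasing F
  SortedE⇒StrictlyIncreasing a↑ F-distinct a↝F j k j<k with a↑ j k j<k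
  ... | inj₁ chain< = subst₂ (λ f g → toℕ f < toℕ g) (a↝F j) (a↝F k) chain<
  ... | inj₂ (same-chain , _) = contradiction
        (F-distinct j k (trans (sym (a↝F j)) (trans same-chain (a↝F k))))
        (λ j≡k → ℕₚ.<-irrefl (cong toℕ j≡k) j<k)

  chains∈cutFamily⇒counted : Vec.map chain a ∈ cutFamily → CountedE x a
  chains∈cutFamily⇒counted chains∈ with chains↑ , chains-sep , chains-¬vsep ← Equivalence.to (∈-cutFamily⇔ {Vec.map chain a}) chains∈ =
      (StrictlyIncreasing⇒SortedE chains↑ , edgeSeparating⇒disconnects-subdivision {Vec.map chain a} {a = a} chains-induce chains-sep)
    , Vec.map chain a , (StrictlyIncreasing⇒injective (Vec.map chain a) chains↑ , edgeSeparating⇒disconnects-W {Vec.map chain a} chains-sep)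
    , chains-sep , chains-¬vsep , chains-induce

  counted⇒chains∈cutFamily : CountedE x a → Vec.map chain a ∈ cutFamily
  counted⇒chains∈cutFamily ((a↑ , _) , F , (F-distinct , _) , F-sep , F-¬vsep , a↝F) =
    subst (_∈ cutFamily) (sym (induced⇒chains a↝F))
      (Equivalence.from (∈-cutFamily⇔ {F}) (SortedE⇒StrictlyIncreasing {F} a↑ F-distinct a↝F , F-sep , F-¬vsep))

length-EnumMu5E : ∀ {x L} → EnumMu5E x L → length L ≡ polynomial ℕ.+-*-rawSemiring x cutFamily
length-EnumMu5E {x} (L! , L-members) = length-enumeration-of-lifts x cutFamily-unique L!
  (λ {a} → mk⇔ (counted⇒chains∈cutFamily a ∘ proj₁ (L-members a)) (proj₂ (L-members a) ∘ chains∈cutFamily⇒counted a))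

cutPolynomial : (WE → ℤ) → ℤ
cutPolynomial v = polynomial ℤ.+-*-rawSemiring v cutFamily

+-length-EnumMu5E : ∀ {x L} → EnumMu5E x L → + length L ≡ cutPolynomial (+_ ∘ x)
+-length-EnumMu5E {x} L-enumerates = trans (cong +_ (length-EnumMu5E L-enumerates))
  (polynomial-homo ℕ.+-*-rawSemiring ℤ.+-*-rawSemiring +_ refl refl (λ _ _ → refl) ℤₚ.pos-* x cutFamily)

edgeSum : {A : Set} → (A → A → A) → (WE → A) → A
edgeSum _+_ f = Vec.foldl₁ _+_ (tabulate f)

-- Over ℤ this is the right-hand side of the theorem; over `Expr` it is the same term as input to
-- the ring solver.
module _ (R : RawRing 0ℓ 0ℓ) (lit : ℕ → RawRing.Carrier R) where
  open RawRing R

  private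
    infixl 6 _-_
    _-_ : Carrier → Carrier → Carrier
    x - y = x + - y

  differenceFormula : Carrier → (WE → Carrier) → Carrier
  differenceFormula N l =
           l8 * l9 * l10 * (N + lit 4 - l1 - l5 - l8 - l9 - l10)
         + l6 * l9 * l12 * (N + lit 5 - l3 - lit 2 * l5 - l6 - l9 - l12)
         + l2 * l3 * l7 * (N + lit 5 - l2 - l3 - lit 2 * l5 - l7 - l12)
         - l3 * l8 * l12 * (N + lit 4 - l1 - l3 - l5 - l8 - l12)
         - l3 * l6 * l10 * (N + lit 3 - lit 2 * l1 - l3 - l6 - l9 - l10)
         - l4 * l7 * l9 * (N + lit 3 - lit 2 * l1 - l4 - l7 - l9 - l10)
         + l4 * l11 * (l1 + lit 1 - l5) * (N + lit 4 - l1 - l4 - l5 - l8 - l11)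
    where
    l1 = l (# 0)
    l2 = l (# 1)
    l3 = l (# 2)
    l4 = l (# 3)
    l5 = l (# 4)
    l6 = l (# 5)
    l7 = l (# 6)
    l8 = l (# 7)
    l9 = l (# 8)
    l10 = l (# 9)
    l11 = l (# 10)
    l12 = l (# 11)

exprRing : RawRing 0ℓ 0ℓ
exprRing = record
  { Carrier = Expr ℤ 12
  ; _≈_     = _≡_
  ; _+_     = _⊕_
  ; _*_     = _⊗_
  ; -_      = ⊝_
  ; 0#      = Κ (+ 0)
  ; 1#      = Κ (+ 1)
  }

shifted : WE → Expr ℤ 12
shifted i = if toℕ i ℕ.≡ᵇ 0 then Ι i ⊕ Κ (+ 1) else (if toℕ i ℕ.≡ᵇ 4 then Ι i ⊕ ⊝ Κ (+ 1) else Ι i)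

cutExpr : (WE → Expr ℤ 12) → Expr ℤ 12
cutExpr σ = polynomial (RawRing.rawSemiring exprRing) σ cutFamily

differenceExpr : Expr ℤ 12
differenceExpr = differenceFormula exprRing (Κ ∘ +_) (edgeSum _⊕_ Ι ⊕ ⊝ Κ (+ 4)) Ι

opaque
  unfolding edgeButNotVertexSeparating?

  cutExpr-difference : ∀ ρ → Ops.⟦ cutExpr Ι ⊕ ⊝ cutExpr shifted ⟧ ρ ≡ Ops.⟦ differenceExpr ⟧ ρ
  cutExpr-difference ρ = Ops.prove ρ (cutExpr Ι ⊕ ⊝ cutExpr shifted) differenceExpr refl

cutPolynomial-difference : ∀ v → cutPolynomial v ℤ.- cutPolynomial (λ i → Ops.⟦ shifted i ⟧ (tabulate v))
  ≡ differenceFormula ℤ.+-*-rawRing +_ (edgeSum ℤ._+_ v ℤ.- + 4) v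
cutPolynomial-difference v = begin
  cutPolynomial v ℤ.- cutPolynomial (eval ∘ shifted)
    ≡⟨ cong (ℤ._- cutPolynomial (eval ∘ shifted)) (polynomial-cong ℤ.+-*-rawSemiring (λ i → sym (lookup∘tabulate v i)) cutFamily) ⟩
  cutPolynomial (lookup ρ) ℤ.- cutPolynomial (eval ∘ shifted)
    ≡⟨ cong₂ ℤ._-_ (evaluate Ι) (evaluate shifted) ⟨
  ⟦ cutExpr Ι ⊕ ⊝ cutExpr shifted ⟧ ρ
    ≡⟨ cutExpr-difference ρ ⟩
  differenceFormula ℤ.+-*-rawRing +_ (edgeSum ℤ._+_ v ℤ.- + 4) v ∎
  where
  open ≡-Reasoning
  open Ops using (⟦_⟧)
  ρ = tabulate v
  eval : Expr ℤ 12 → ℤ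
  eval e = ⟦ e ⟧ ρ
  evaluate : ∀ σ → ⟦ cutExpr σ ⟧ ρ ≡ cutPolynomial (eval ∘ σ)
  evaluate σ = polynomial-homo (RawRing.rawSemiring exprRing) ℤ.+-*-rawSemiring eval
                 refl refl (λ _ _ → refl) (λ _ _ → refl) σ cutFamily

indicatorX : ℕ → WE → ℕ
indicatorX r i = if inX r i then 1 else 0

size-X : ∀ r → r < 12 → edgeSum ℕ._+_ (indicatorX r) ≡ r
size-X r r<12 = subst (λ k → edgeSum ℕ._+_ (indicatorX k) ≡ k) (Finₚ.toℕ-fromℕ< r<12) (by-computation (Fin.fromℕ< r<12))
  where
  by-computation : ∀ (r : Fin 12) → edgeSum ℕ._+_ (indicatorX (toℕ r)) ≡ toℕ r
  by-computation = toWitness {a? = all? λ r → edgeSum ℕ._+_ (indicatorX (toℕ r)) ℕ.≟ toℕ r} tt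

module _ where
  open import Data.Nat using (_+_; _*_)

  edgeSum-ℓ : ∀ n → edgeSum ℕ._+_ (ℓ n) ≡ n ℕ.+ 4
  edgeSum-ℓ n = begin
    edgeSum _+_ (ℓ n)                                 ≡⟨ edgeSum-+ (sPar n) (indicatorX (rPar n)) ⟩
    edgeSum _+_ (indicatorX (rPar n)) + sPar n * 12   ≡⟨ cong (_+ sPar n * 12) (size-X (rPar n) (m%n<n (n + 4) 12)) ⟩
    rPar n + sPar n * 12                              ≡⟨ m≡m%n+[m/n]*n (n + 4) 12 ⟨
    n + 4                                             ∎
    where
    open ≡-Reasoning
    twelve-terms : ∀ s b0 b1 b2 b3 b4 b5 b6 b7 b8 b9 b10 b11 →
      (s + b0) + (s + b1) + (s + b2) + (s + b3) + (s + b4) + (s + b5)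
        + (s + b6) + (s + b7) + (s + b8) + (s + b9) + (s + b10) + (s + b11)
      ≡ (b0 + b1 + b2 + b3 + b4 + b5 + b6 + b7 + b8 + b9 + b10 + b11) + s * 12
    twelve-terms = ℕ-Solver.solve-∀
    edgeSum-+ : ∀ s b → edgeSum _+_ (λ i → s + b i) ≡ edgeSum _+_ b + s * 12
    edgeSum-+ s b = twelve-terms s (b (# 0)) (b (# 1)) (b (# 2)) (b (# 3)) (b (# 4)) (b (# 5))
                                   (b (# 6)) (b (# 7)) (b (# 8)) (b (# 9)) (b (# 10)) (b (# 11))

ℓ-positive : ∀ {n} → 8 ≤ n → ∀ i → 1 ≤ ℓ n i
ℓ-positive {n} 8≤n i = ℕₚ.≤-trans (m≥n⇒m/n>0 {n ℕ.+ 4} {12} (ℕₚ.+-monoˡ-≤ 4 8≤n)) (ℕₚ.m≤m+n (sPar n) _)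

ℓ′≡shifted : ∀ {n} → 8 ≤ n → ∀ i → + ℓ' n i ≡ Ops.⟦ shifted i ⟧ (tabulate (+_ ∘ ℓ n))
ℓ′≡shifted {n} 8≤n i = agrees (toℕ i ℕ.≡ᵇ 0) (toℕ i ℕ.≡ᵇ 4) (lookup∘tabulate (+_ ∘ ℓ n) i) (ℓ-positive 8≤n i)
  where
  ρ = tabulate (+_ ∘ ℓ n)
  agrees : ∀ b c {m} → lookup ρ i ≡ + m → 1 ≤ m →
    + (if b then m ℕ.+ 1 else (if c then m ℕ.∸ 1 else m))
      ≡ Ops.⟦ if b then Ι i ⊕ Κ (+ 1) else (if c then Ι i ⊕ ⊝ Κ (+ 1) else Ι i) ⟧ ρ
  agrees true  _     ρi≡m _       = cong (ℤ._+ + 1) (sym ρi≡m)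
  agrees false true  ρi≡m (s≤s _) = cong (ℤ._- + 1) (sym ρi≡m)
  agrees false false ρi≡m _       = sym ρi≡m

edgeSum-+ℓ : ∀ n → edgeSum ℤ._+_ (+_ ∘ ℓ n) ℤ.- + 4 ≡ + n
edgeSum-+ℓ n = trans (cong (λ m → + m ℤ.- + 4) (edgeSum-ℓ n)) (cancel-4 (+ n))
  where
  cancel-4 : ∀ m → m ℤ.+ + 4 ℤ.- + 4 ≡ m
  cancel-4 = ℤ-Solver.solve-∀

open import Data.Integer using (_+_; _-_; _*_)

lemma13 : (n : ℕ) → 13 ≤ n → n ≢ 16 →
  (LG : List (Vec (GE (xG n)) 5)) → EnumMu5E (xG n) LG →
  (LH : List (Vec (GE (xH n)) 5)) → EnumMu5E (xH n) LH →
  let N = + n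
      l1 = + ℓ n (# 0)
      l2 = + ℓ n (# 1)
      l3 = + ℓ n (# 2)
      l4 = + ℓ n (# 3)
      l5 = + ℓ n (# 4)
      l6 = + ℓ n (# 5)
      l7 = + ℓ n (# 6)
      l8 = + ℓ n (# 7)
      l9 = + ℓ n (# 8)
      l10 = + ℓ n (# 9)
      l11 = + ℓ n (# 10)
      l12 = + ℓ n (# 11)
  in (+ length LG) - (+ length LH) ≡
       l8 * l9 * l10 * (N + + 4 - l1 - l5 - l8 - l9 - l10)
     + l6 * l9 * l12 * (N + + 5 - l3 - + 2 * l5 - l6 - l9 - l12)
     + l2 * l3 * l7 * (N + + 5 - l2 - l3 - + 2 * l5 - l7 - l12)
     - l3 * l8 * l12 * (N + + 4 - l1 - l3 - l5 - l8 - l12)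
     - l3 * l6 * l10 * (N + + 3 - + 2 * l1 - l3 - l6 - l9 - l10)
     - l4 * l7 * l9 * (N + + 3 - + 2 * l1 - l4 - l7 - l9 - l10)
     + l4 * l11 * (l1 + + 1 - l5) * (N + + 4 - l1 - l4 - l5 - l8 - l11)
lemma13 n 13≤n _ LG LG-enumerates LH LH-enumerates = begin
  + length LG - + length LH
    ≡⟨ cong₂ _-_ (+-length-EnumMu5E LG-enumerates) (+-length-EnumMu5E LH-enumerates) ⟩
  cutPolynomial (+_ ∘ ℓ n) - cutPolynomial (+_ ∘ ℓ' n)
    ≡⟨ cong (cutPolynomial (+_ ∘ ℓ n) -_) (polynomial-cong ℤ.+-*-rawSemiring (ℓ′≡shifted 8≤n) cutFamily) ⟩
  cutPolynomial (+_ ∘ ℓ n) - cutPolynomial (λ i → Ops.⟦ shifted i ⟧ (tabulate (+_ ∘ ℓ n)))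
    ≡⟨ cutPolynomial-difference (+_ ∘ ℓ n) ⟩
  differenceFormula ℤ.+-*-rawRing +_ (edgeSum _+_ (+_ ∘ ℓ n) - + 4) (+_ ∘ ℓ n)
    ≡⟨ cong (λ N → differenceFormula ℤ.+-*-rawRing +_ N (+_ ∘ ℓ n)) (edgeSum-+ℓ n) ⟩
  differenceFormula ℤ.+-*-rawRing +_ (+ n) (+_ ∘ ℓ n) ∎
  where
  open ≡-Reasoning
  8≤n : 8 ≤ n
  8≤n = ℕₚ.≤-trans (ℕₚ.m≤m+n 8 5) 13≤n
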